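{- Let $G$ be a connected graph without cut-vertex that is not a clique and in which no vertex has a neighborhood that is a stable set. If $Q$ is a clique module of $G$ with $|Q|\ge 3$, then for each $v\in Q$, $G$ has a stable cutset if and only if $G-v$ has a stable cutset.
   Context: All graphs are finite and simple. A stable cutset of a graph $G$ is a set $S\subseteq V(G)$ whose vertices are pairwise non-adjacent and such that $G-S$ is disconnected (has at least two connected components); the empty set is a stable cutset of any disconnected graph. A cut-vertex is a vertex whose removal disconnects the graph. A set $M\subseteq V(G)$ is a module of $G$ if $N(u)\setminus M=N(v)\setminus M$ for all $u,v\in M$; a clique module is a module that is a clique. -}

module Defs where

open import Data.Nat using (ℕ)
open import Data.Bool using (Bool; true; false; if_then_else_)
open import Data.Vec using (tabulate)
open import Data.Fin using (Fin)
open import Data.Fin.Subset using (Subset; _∈_; _∉_; _⊆_; _─_; _-_; ⊤; inside; outside)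
open import Data.Product using (Σ; ∃; _×_; _,_)
open import Relation.Binary.PropositionalEquality using (_≡_)
open import Relation.Nullary using (¬_)

record Graph (n : ℕ) : Set where
  field
    adj    : Fin n → Fin n → Bool
    sym    : ∀ u v → adj u v ≡ adj v u
    irrefl : ∀ v → adj v v ≡ false

open Graph public

module _ {n : ℕ} (G : Graph n) where

  Adj : Fin n → Fin n → Set
  Adj u v = adj G u v ≡ true

  data Path (W : Subset n) : Fin n → Fin n → Set where
    here : ∀ {u} → u ∈ W → Path W u u
    step : ∀ {u w v} → u ∈ W → Adj u w → Path W w v → Path W u v

  Connected : Subset n → Set
  Connected W = ∀ u v → u ∈ W → v ∈ W → Path W u v

  Disconnected : Subset n → Set
  Disconnected W = Σ (Fin n) λ u → Σ (Fin n) λ v →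
    u ∈ W × v ∈ W × ¬ Path W u v

  Stable : Subset n → Set
  Stable S = ∀ u v → u ∈ S → v ∈ S → ¬ Adj u v

  Clique : Subset n → Set
  Clique S = ∀ u v → u ∈ S → v ∈ S → ¬ u ≡ v → Adj u v

  StableCutset : Subset n → Subset n → Set
  StableCutset W S = S ⊆ W × Stable S × Disconnected (W ─ S)

  HasStableCutset : Subset n → Set
  HasStableCutset W = ∃ λ S → StableCutset W S

  CutVertex : Fin n → Set
  CutVertex v = Disconnected (⊤ - v)

  Nbhd : Fin n → Subset n
  Nbhd v = tabulate λ x → if adj G v x then inside else outside

  IsModule : Subset n → Set
  IsModule M = ∀ u v x → u ∈ M → v ∈ M → x ∉ M → adj G u x ≡ adj G v x

{-# OPTIONS --safe #-}
module Submission where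

open import Defs hiding (sym)
open import Data.Nat using (ℕ; _+_; _≥_; _≤_; s≤s; s≤s⁻¹; z≤n)
open import Data.Nat.Properties using (≤-trans; n≤1+n; ≤-refl)
open import Data.Fin using (Fin; _≟_) renaming (zero to fzero; suc to fsuc)
open import Data.Fin.Subset
  using (Subset; _∈_; _∉_; ∣_∣; ⊤; _-_; _─_; _⊆_; ⁅_⁆; Nonempty; inside; outside)
open import Data.Fin.Subset.Properties
  using (∈⊤; x∈p∧x∉q⇒x∈p─q; p─q⊆p; x∈p∧x≢y⇒x∈p-y; x∉⁅y⁆⇒x≢y; p─⊥≡p; _∈?_)
open import Data.Vec using (_∷_; here; there)
open import Data.Product using (_×_; _,_; ∃; map)
open import Data.Sum using (_⊎_; inj₁; inj₂)
open import Relation.Binary.PropositionalEquality using (_≡_; _≢_; refl; sym; trans; subst; subst₂)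
open import Relation.Nullary using (¬_; yes; no; contradiction)
open import Function.Bundles using (_⇔_; mk⇔; Equivalence)

-- Let q ≠ v satisfy N[v] ⊆ N[q]; every other vertex of the clique module Q
-- does. Replacing v by q maps walks of G − S to walks of G − v − S whenever
-- q ∉ S, so G − S is disconnected iff G − v − (S − v) is, whether or not
-- v ∈ S. A stable set meets the clique Q at most once, so as ∣Q∣ ≥ 3 such a
-- q outside any stable S exists.

x∈p─q⇒x∉q : ∀ {n} {x : Fin n} (p q : Subset n) → x ∈ p ─ q → x ∉ q
x∈p─q⇒x∉q (_ ∷ p) (outside ∷ q) here      ()
x∈p─q⇒x∉q (_ ∷ p) (_ ∷ q)       (there m) (there m′) = x∈p─q⇒x∉q p q m m′

x∈p-y⇒x≢y : ∀ {n} {x y : Fin n} {p : Subset n} → x ∈ p - y → x ≢ y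
x∈p-y⇒x≢y {y = y} {p = p} m = x∉⁅y⁆⇒x≢y (x∈p─q⇒x∉q p ⁅ y ⁆ m)

∣p∣≤1+∣p-x∣ : ∀ {n} (p : Subset n) (x : Fin n) → ∣ p ∣ ≤ 1 + ∣ p - x ∣
∣p∣≤1+∣p-x∣ (inside  ∷ p) fzero    = subst (λ r → 1 + ∣ p ∣ ≤ 1 + ∣ r ∣) (sym (p─⊥≡p p)) ≤-refl
∣p∣≤1+∣p-x∣ (outside ∷ p) fzero    = subst (λ r → ∣ p ∣ ≤ 1 + ∣ r ∣) (sym (p─⊥≡p p)) (n≤1+n ∣ p ∣)
∣p∣≤1+∣p-x∣ (inside  ∷ p) (fsuc x) = s≤s (∣p∣≤1+∣p-x∣ p x)
∣p∣≤1+∣p-x∣ (outside ∷ p) (fsuc x) = ∣p∣≤1+∣p-x∣ p x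

1+k≤∣p∣⇒k≤∣p-x∣ : ∀ {n k} (p : Subset n) (x : Fin n) → 1 + k ≤ ∣ p ∣ → k ≤ ∣ p - x ∣
1+k≤∣p∣⇒k≤∣p-x∣ p x 1+k≤∣p∣ = s≤s⁻¹ (≤-trans 1+k≤∣p∣ (∣p∣≤1+∣p-x∣ p x))

1≤∣p∣⇒Nonempty : ∀ {n} (p : Subset n) → 1 ≤ ∣ p ∣ → Nonempty p
1≤∣p∣⇒Nonempty (inside  ∷ p) _ = fzero , here
1≤∣p∣⇒Nonempty (outside ∷ p) h = map fsuc there (1≤∣p∣⇒Nonempty p h)

redirect : ∀ {n} → Fin n → Fin n → Fin n → Fin n
redirect v q x with x ≟ v
... | yes _ = q
... | no  _ = x

redirect-≢ : ∀ {n} {v q x : Fin n} → x ≢ v → redirect v q x ≡ x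
redirect-≢ {v = v} {x = x} x≢v with x ≟ v
... | yes x≡v = contradiction x≡v x≢v
... | no  _   = refl

module _ {n : ℕ} (G : Graph n) where

  Adj-sym : ∀ {u v} → Adj G u v → Adj G v u
  Adj-sym {u} {v} e = trans (Graph.sym G v u) e

  Adj-irrefl : ∀ {v} → ¬ Adj G v v
  Adj-irrefl {v} e with () ← trans (sym (irrefl G v)) e

  Path-start : ∀ {W a b} → Path G W a b → a ∈ W
  Path-start (here a∈W)     = a∈W
  Path-start (step a∈W _ _) = a∈W

  Path-mono : ∀ {W W′} → W ⊆ W′ → ∀ {a b} → Path G W a b → Path G W′ a b
  Path-mono W⊆W′ (here a∈W)     = here (W⊆W′ a∈W)
  Path-mono W⊆W′ (step a∈W e p) = step (W⊆W′ a∈W) e (Path-mono W⊆W′ p)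

  _++ᴾ_ : ∀ {W a b c} → Path G W a b → Path G W b c → Path G W a c
  here _       ++ᴾ q = q
  step a∈W e p ++ᴾ q = step a∈W e (p ++ᴾ q)

  infixr 5 _++ᴾ_

  Path-edge : ∀ {W a b} → a ∈ W → b ∈ W → Adj G a b → Path G W a b
  Path-edge a∈W b∈W e = step a∈W e (here b∈W)

  Path-reverse : ∀ {W a b} → Path G W a b → Path G W b a
  Path-reverse (here a∈W)     = here a∈W
  Path-reverse (step a∈W e p) = Path-reverse p ++ᴾ Path-edge (Path-start p) a∈W (Adj-sym e)

  DominatedBy : Fin n → Fin n → Set
  DominatedBy v q = ∀ c → Adj G v c → c ≡ q ⊎ Adj G q c

  Path-redirect-start : ∀ {W v q x} → Adj G v q → q ∈ W → x ∈ W → Path G W x (redirect v q x)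
  Path-redirect-start {v = v} {x = x} v~q q∈W x∈W with x ≟ v
  ... | yes refl = Path-edge x∈W q∈W v~q
  ... | no  _    = here x∈W

  module _ {v q : Fin n} {W W′ : Subset n} (v◁q : DominatedBy v q)
           (W-v⊆W′ : ∀ {x} → x ∈ W → x ≢ v → x ∈ W′) (q∈W′ : q ∈ W′) where

    redirect-∈ : ∀ {x} → x ∈ W → redirect v q x ∈ W′
    redirect-∈ {x} x∈W with x ≟ v
    ... | yes _   = q∈W′
    ... | no  x≢v = W-v⊆W′ x∈W x≢v

    Path-from-neighbour : ∀ {c} → Adj G v c → c ∈ W′ → Path G W′ q c
    Path-from-neighbour {c} v~c c∈W′ with v◁q c v~c
    ... | inj₁ refl = here c∈W′
    ... | inj₂ q~c  = Path-edge q∈W′ c∈W′ q~c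

    Path-redirect-edge : ∀ {a b} → a ∈ W → b ∈ W → Adj G a b →
                         Path G W′ (redirect v q a) (redirect v q b)
    Path-redirect-edge {a} {b} a∈W b∈W a~b with a ≟ v | b ≟ v
    ... | yes refl | yes refl = contradiction a~b Adj-irrefl
    ... | yes refl | no  b≢v  = Path-from-neighbour a~b (W-v⊆W′ b∈W b≢v)
    ... | no  a≢v  | yes refl = Path-reverse (Path-from-neighbour (Adj-sym a~b) (W-v⊆W′ a∈W a≢v))
    ... | no  a≢v  | no  b≢v  = Path-edge (W-v⊆W′ a∈W a≢v) (W-v⊆W′ b∈W b≢v) a~b

    Path-redirect : ∀ {a b} → Path G W a b → Path G W′ (redirect v q a) (redirect v q b)
    Path-redirect (here a∈W)       = here (redirect-∈ a∈W)
    Path-redirect (step a∈W a~c p) = Path-redirect-edge a∈W (Path-start p) a~c ++ᴾ Path-redirect p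

  Disconnected-delete-dominated :
    ∀ {v q W W′} → Adj G v q → DominatedBy v q →
    W′ ⊆ W → (∀ {x} → x ∈ W → x ≢ v → x ∈ W′) → v ∉ W′ → q ∈ W′ →
    Disconnected G W ⇔ Disconnected G W′
  Disconnected-delete-dominated {v} {q} {W} {W′} v~q v◁q W′⊆W W-v⊆W′ v∉W′ q∈W′ = mk⇔ to from
    where
    to : Disconnected G W → Disconnected G W′
    to (a , b , a∈W , b∈W , a≁b) =
      redirect v q a , redirect v q b ,
      redirect-∈ v◁q W-v⊆W′ q∈W′ a∈W , redirect-∈ v◁q W-v⊆W′ q∈W′ b∈W ,
      λ p → a≁b (Path-redirect-start v~q (W′⊆W q∈W′) a∈W
                 ++ᴾ Path-mono W′⊆W p
                 ++ᴾ Path-reverse (Path-redirect-start v~q (W′⊆W q∈W′) b∈W))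

    ≢v : ∀ {x} → x ∈ W′ → x ≢ v
    ≢v x∈W′ refl = v∉W′ x∈W′

    from : Disconnected G W′ → Disconnected G W
    from (a , b , a∈W′ , b∈W′ , a≁b) =
      a , b , W′⊆W a∈W′ , W′⊆W b∈W′ ,
      λ p → a≁b (subst₂ (Path G W′) (redirect-≢ (≢v a∈W′)) (redirect-≢ (≢v b∈W′))
                        (Path-redirect v◁q W-v⊆W′ q∈W′ p))

  Disconnected-delete-dominated-cut :
    ∀ {v q S T} → Adj G v q → DominatedBy v q →
    T ⊆ S → (∀ {x} → x ∈ S → x ≢ v → x ∈ T) → q ∉ S →
    Disconnected G (⊤ ─ S) ⇔ Disconnected G ((⊤ - v) ─ T)
  Disconnected-delete-dominated-cut {v} {q} {S} {T} v~q v◁q T⊆S S-v⊆T q∉S =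
    Disconnected-delete-dominated v~q v◁q W′⊆W W-v⊆W′ v∉W′ q∈W′
    where
    W′⊆W : (⊤ - v) ─ T ⊆ ⊤ ─ S
    W′⊆W x∈W′ = x∈p∧x∉q⇒x∈p─q ∈⊤ λ x∈S →
      x∈p─q⇒x∉q (⊤ - v) T x∈W′ (S-v⊆T x∈S (x∈p-y⇒x≢y (p─q⊆p (⊤ - v) T x∈W′)))

    W-v⊆W′ : ∀ {x} → x ∈ ⊤ ─ S → x ≢ v → x ∈ (⊤ - v) ─ T
    W-v⊆W′ x∈W x≢v = x∈p∧x∉q⇒x∈p─q (x∈p∧x≢y⇒x∈p-y ∈⊤ x≢v) λ x∈T → x∈p─q⇒x∉q ⊤ S x∈W (T⊆S x∈T)

    v∉W′ : v ∉ (⊤ - v) ─ T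
    v∉W′ v∈W′ = x∈p-y⇒x≢y (p─q⊆p (⊤ - v) T v∈W′) refl

    q∈W′ : q ∈ (⊤ - v) ─ T
    q∈W′ = W-v⊆W′ (x∈p∧x∉q⇒x∈p─q ∈⊤ q∉S) λ { refl → Adj-irrefl v~q }

  clique-module-dominated : ∀ {Q v q} → IsModule G Q → Clique G Q → v ∈ Q → q ∈ Q → DominatedBy v q
  clique-module-dominated {Q} {v} {q} Q-module Q-clique v∈Q q∈Q c v~c with c ≟ q | c ∈? Q
  ... | yes c≡q | _       = inj₁ c≡q
  ... | no  c≢q | yes c∈Q = inj₂ (Q-clique q c q∈Q c∈Q λ q≡c → c≢q (sym q≡c))
  ... | no  _   | no  c∉Q = inj₂ (trans (Q-module q v c q∈Q v∈Q c∉Q) v~c)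

  Stable-⊆ : ∀ {S T} → T ⊆ S → Stable G S → Stable G T
  Stable-⊆ T⊆S S-stable u v u∈T v∈T = S-stable u v (T⊆S u∈T) (T⊆S v∈T)

  Stable-meets-Clique-once : ∀ {Q S x y} → Clique G Q → Stable G S →
                             x ∈ Q → x ∈ S → y ∈ Q → y ≢ x → y ∉ S
  Stable-meets-Clique-once Q-clique S-stable x∈Q x∈S y∈Q y≢x y∈S =
    S-stable _ _ x∈S y∈S (Q-clique _ _ x∈Q y∈Q λ x≡y → y≢x (sym x≡y))

  clique-avoids-stable : ∀ {Q S} → Clique G Q → 3 ≤ ∣ Q ∣ → Stable G S →
                         ∀ v → ∃ λ q → q ∈ Q × q ≢ v × q ∉ S
  clique-avoids-stable {Q} {S} Q-clique 3≤∣Q∣ S-stable v = choose (1≤∣p∣⇒Nonempty (Q - v) 1≤∣Q-v∣)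
    where
    2≤∣Q-v∣ : 2 ≤ ∣ Q - v ∣
    2≤∣Q-v∣ = 1+k≤∣p∣⇒k≤∣p-x∣ Q v 3≤∣Q∣

    1≤∣Q-v∣ : 1 ≤ ∣ Q - v ∣
    1≤∣Q-v∣ = ≤-trans (s≤s z≤n) 2≤∣Q-v∣

    choose : Nonempty (Q - v) → ∃ λ q → q ∈ Q × q ≢ v × q ∉ S
    choose (q₁ , q₁∈Q-v) with q₁ ∈? S
    ... | no q₁∉S = q₁ , p─q⊆p Q ⁅ v ⁆ q₁∈Q-v , x∈p-y⇒x≢y q₁∈Q-v , q₁∉S
    ... | yes q₁∈S =
      let q₂ , q₂∈Q-v-q₁ = 1≤∣p∣⇒Nonempty (Q - v - q₁) (1+k≤∣p∣⇒k≤∣p-x∣ (Q - v) q₁ 2≤∣Q-v∣)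
          q₂∈Q-v = p─q⊆p (Q - v) ⁅ q₁ ⁆ q₂∈Q-v-q₁
          q₂∈Q   = p─q⊆p Q ⁅ v ⁆ q₂∈Q-v
      in  q₂ , q₂∈Q , x∈p-y⇒x≢y q₂∈Q-v ,
          Stable-meets-Clique-once Q-clique S-stable (p─q⊆p Q ⁅ v ⁆ q₁∈Q-v) q₁∈S q₂∈Q (x∈p-y⇒x≢y q₂∈Q-v-q₁)

lemma7 : {n : ℕ} (G : Graph n) →
    Connected G ⊤ →
    (∀ v → ¬ CutVertex G v) →
    ¬ Clique G ⊤ →
    (∀ v → ¬ Stable G (Nbhd G v)) →
    (Q : Subset n) → IsModule G Q → Clique G Q → ∣ Q ∣ ≥ 3 →
    (v : Fin n) → v ∈ Q →
    HasStableCutset G ⊤ ⇔ HasStableCutset G (⊤ - v)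
lemma7 G _ _ _ _ Q Q-module Q-clique 3≤∣Q∣ v v∈Q = mk⇔ forward backward
  where
  cut-transfer : ∀ {S T} → Stable G S → T ⊆ S → (∀ {x} → x ∈ S → x ≢ v → x ∈ T) →
                 Disconnected G (⊤ ─ S) ⇔ Disconnected G ((⊤ - v) ─ T)
  cut-transfer S-stable T⊆S S-v⊆T =
    let q , q∈Q , q≢v , q∉S = clique-avoids-stable G Q-clique 3≤∣Q∣ S-stable v
    in  Disconnected-delete-dominated-cut G (Q-clique v q v∈Q q∈Q λ v≡q → q≢v (sym v≡q))
          (clique-module-dominated G Q-module Q-clique v∈Q q∈Q) T⊆S S-v⊆T q∉S

  forward : HasStableCutset G ⊤ → HasStableCutset G (⊤ - v)
  forward (S , _ , S-stable , G-S-disconnected) =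
    S - v , (λ x∈S-v → x∈p∧x≢y⇒x∈p-y ∈⊤ (x∈p-y⇒x≢y x∈S-v)) , Stable-⊆ G S-v⊆S S-stable ,
    Equivalence.to (cut-transfer S-stable S-v⊆S x∈p∧x≢y⇒x∈p-y) G-S-disconnected
    where
    S-v⊆S : S - v ⊆ S
    S-v⊆S = p─q⊆p S ⁅ v ⁆

  backward : HasStableCutset G (⊤ - v) → HasStableCutset G ⊤
  backward (S , _ , S-stable , G-v-S-disconnected) =
    S , (λ _ → ∈⊤) , S-stable ,
    Equivalence.from (cut-transfer S-stable (λ x∈S → x∈S) (λ x∈S _ → x∈S)) G-v-S-disconnected
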